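{- Let $F$ be a DeMorgan circuit computing a Boolean function $f:\{0,1\}^n\to\{0,1\}$. Then the monotone version $F^+$ computes $f^{\uparrow}$ if and only if for every zero-term $t$ produced by $F$, its positive factor $t^+$ satisfies $t^+\le f^{\uparrow}$ (i.e., is an implicant of $f^{\uparrow}$).
   Context: A DeMorgan circuit on $x_1,\dots,x_n$ has fan-in-2 AND/OR gates and inputs $0,1,x_i,\bar x_i$. A term is an AND of literals; a zero-term contains some $x_i$ together with $\bar x_i$. Produced terms: at an input gate, the literal/constant itself; at an OR gate, the union of the sets of terms produced at its two inputs; at an AND gate, all $t_1\land t_2$ with $t_1,t_2$ produced at the two inputs (the law $x\bar x=0$ is not applied, so zero-terms may be produced). The upwards closure is $f^{\uparrow}(x)=\bigvee_{z\le x}f(z)$. The monotone version $F^+$ is obtained by replacing every negated input $\bar x_i$ by the constant $1$. The positive factor $t^+$ of a term $t$ is obtained by replacing each negated literal in $t$ by the constant $1$. -}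

module Defs where

open import Data.Nat using (ℕ)
open import Data.Fin using (Fin)
open import Data.Bool using (Bool; true; false; _∧_; _∨_; not; _≤_)
open import Data.List using (List; []; _∷_; _++_; [_])
open import Data.List.Membership.Propositional using (_∈_)
open import Data.Empty using (⊥)
open import Data.Product using (Σ; _×_; ∃)
open import Relation.Binary.PropositionalEquality using (_≡_)

Input : ℕ → Set
Input n = Fin n → Bool

_≤ᵥ_ : ∀ {n} → Input n → Input n → Set
z ≤ᵥ x = ∀ i → z i ≤ x i

data Literal (n : ℕ) : Set where
  pos : Fin n → Literal n
  neg : Fin n → Literal n

evalLit : ∀ {n} → Literal n → Input n → Bool
evalLit (pos i) x = x i
evalLit (neg i) x = not (x i)

data Circuit (n : ℕ) : Set where
  const : Bool → Circuit n
  lit   : Literal n → Circuit n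
  and   : Circuit n → Circuit n → Circuit n
  or    : Circuit n → Circuit n → Circuit n

eval : ∀ {n} → Circuit n → Input n → Bool
eval (const b) x = b
eval (lit l) x = evalLit l x
eval (and F G) x = eval F x ∧ eval G x
eval (or F G) x = eval F x ∨ eval G x

mono : ∀ {n} → Circuit n → Circuit n
mono (const b) = const b
mono (lit (pos i)) = lit (pos i)
mono (lit (neg i)) = const true
mono (and F G) = and (mono F) (mono G)
mono (or F G) = or (mono F) (mono G)

-- upwards closure: f↑(x) = ∨_{z ≤ x} f(z)  (as a proposition)
Up : ∀ {n} → (Input n → Bool) → Input n → Set
Up f x = Σ (Input _) (λ z → (z ≤ᵥ x) × (f z ≡ true))

-- terms: an AND of literals (a list; [] is the constant 1),
-- or the constant 0 (produced at a 0 input gate)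
data Term (n : ℕ) : Set where
  zeroT : Term n
  lits  : List (Literal n) → Term n

evalLits : ∀ {n} → List (Literal n) → Input n → Bool
evalLits [] x = true
evalLits (l ∷ ls) x = evalLit l x ∧ evalLits ls x

evalTerm : ∀ {n} → Term n → Input n → Bool
evalTerm zeroT x = false
evalTerm (lits ls) x = evalLits ls x

-- t₁ ∧ t₂ (no simplification; x x̄ = 0 is NOT applied)
_∧ₜ_ : ∀ {n} → Term n → Term n → Term n
zeroT ∧ₜ t = zeroT
lits ls ∧ₜ zeroT = zeroT
lits ls ∧ₜ lits ms = lits (ls ++ ms)

ZeroTerm : ∀ {n} → Term n → Set
ZeroTerm zeroT = ⊥
ZeroTerm (lits ls) = ∃ λ i → (pos i ∈ ls) × (neg i ∈ ls)

posLits : ∀ {n} → List (Literal n) → List (Literal n)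
posLits [] = []
posLits (pos i ∷ ls) = pos i ∷ posLits ls
posLits (neg i ∷ ls) = posLits ls

posPart : ∀ {n} → Term n → Term n
posPart zeroT = zeroT
posPart (lits ls) = lits (posLits ls)

data Produces {n : ℕ} : Circuit n → Term n → Set where
  p-one  : Produces (const true) (lits [])
  p-zero : Produces (const false) zeroT
  p-lit  : ∀ l → Produces (lit l) (lits [ l ])
  p-orˡ  : ∀ {F G t} → Produces F t → Produces (or F G) t
  p-orʳ  : ∀ {F G t} → Produces G t → Produces (or F G) t
  p-and  : ∀ {F G t₁ t₂} → Produces F t₁ → Produces G t₂ → Produces (and F G) (t₁ ∧ₜ t₂)

Computes : ∀ {n} → Circuit n → (Input n → Set) → Set
Computes F g = ∀ x → (eval F x ≡ true → g x) × (g x → eval F x ≡ true)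

Implicant : ∀ {n} → Term n → (Input n → Set) → Set
Implicant t g = ∀ x → evalTerm t x ≡ true → g x

-- Every produced term t satisfies t ≤ F, and F⁺(x) = 1 exactly when t⁺(x) = 1 for some
-- produced t; moreover F⁺ is monotone and F ≤ F⁺, so always f↑ ≤ F⁺. Hence F⁺ = f↑ iff
-- t⁺ ≤ f↑ for every produced t. For a term t that is not a zero-term this holds
-- automatically: setting exactly the variables occurring positively in t gives an input
-- z with t(z) = 1, and z ≤ x whenever t⁺(x) = 1. So only the zero-terms need checking.
module Submission where

open import Defs
open import Data.Nat using (ℕ)
open import Data.Fin using (_≟_)
open import Data.Bool using (Bool; true; false; _∧_; _∨_; _≤_; b≤b)
open import Data.Bool.Properties using (∧-assoc; ∧-zeroʳ; ∧-identityʳ; ∨-zeroʳ; ≤-minimum; ≤-reflexive)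
open import Data.List using (List; []; _∷_; _++_; [_])
open import Data.List.Membership.Propositional using (_∈_)
open import Data.List.Relation.Binary.Subset.Propositional using (_⊆_)
open import Data.List.Relation.Unary.Any using (here; there; any?)
open import Data.Product using (Σ; _×_; _,_; proj₁; proj₂)
open import Data.Sum using (_⊎_; inj₁; inj₂)
import Data.Sum as Sum
open import Function using (_∘_)
open import Function.Bundles using (_⇔_; mk⇔)
open import Relation.Binary.Definitions using (DecidableEquality)
open import Relation.Nullary using (does; yes; no)
import Relation.Nullary.Decidable as Dec
open import Relation.Binary.PropositionalEquality using (_≡_; refl; sym; trans; cong)

private
  variable
    n : ℕ
    a b c d : Bool

∧-true : a ≡ true → b ≡ true → a ∧ b ≡ true
∧-true refl refl = refl

∧-true⁻ : a ∧ b ≡ true → (a ≡ true) × (b ≡ true)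
∧-true⁻ {true} {true} _ = refl , refl

∨-trueˡ : a ≡ true → a ∨ b ≡ true
∨-trueˡ refl = refl

∨-trueʳ : b ≡ true → a ∨ b ≡ true
∨-trueʳ {a = a} refl = ∨-zeroʳ a

∨-true⁻ : a ∨ b ≡ true → (a ≡ true) ⊎ (b ≡ true)
∨-true⁻ {true}  _ = inj₁ refl
∨-true⁻ {false} e = inj₂ e

≤-true : a ≤ b → a ≡ true → b ≡ true
≤-true b≤b e = e

∧-true-map : (a ≡ true → c ≡ true) → (b ≡ true → d ≡ true) → a ∧ b ≡ true → c ∧ d ≡ true
∧-true-map f g e = let ea , eb = ∧-true⁻ e in ∧-true (f ea) (g eb)

∨-true-map : (a ≡ true → c ≡ true) → (b ≡ true → d ≡ true) → a ∨ b ≡ true → c ∨ d ≡ true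
∨-true-map f g = Sum.[ ∨-trueˡ ∘ f , ∨-trueʳ ∘ g ] ∘ ∨-true⁻

_≟ₗ_ : DecidableEquality (Literal n)
pos i ≟ₗ pos j = Dec.map′ (cong pos) (λ { refl → refl }) (i ≟ j)
neg i ≟ₗ neg j = Dec.map′ (cong neg) (λ { refl → refl }) (i ≟ j)
pos _ ≟ₗ neg _ = no λ ()
neg _ ≟ₗ pos _ = no λ ()

evalLits-++ : ∀ (ls ms : List (Literal n)) x →
  evalLits (ls ++ ms) x ≡ evalLits ls x ∧ evalLits ms x
evalLits-++ []       ms x = refl
evalLits-++ (l ∷ ls) ms x =
  trans (cong (evalLit l x ∧_) (evalLits-++ ls ms x)) (sym (∧-assoc (evalLit l x) _ _))

evalTerm-∧ₜ : ∀ (t u : Term n) x → evalTerm (t ∧ₜ u) x ≡ evalTerm t x ∧ evalTerm u x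
evalTerm-∧ₜ zeroT     u         x = refl
evalTerm-∧ₜ (lits ls) zeroT     x = sym (∧-zeroʳ (evalLits ls x))
evalTerm-∧ₜ (lits ls) (lits ms) x = evalLits-++ ls ms x

posLits-++ : ∀ (ls ms : List (Literal n)) → posLits (ls ++ ms) ≡ posLits ls ++ posLits ms
posLits-++ []           ms = refl
posLits-++ (pos i ∷ ls) ms = cong (pos i ∷_) (posLits-++ ls ms)
posLits-++ (neg i ∷ ls) ms = posLits-++ ls ms

posPart-∧ₜ : ∀ (t u : Term n) → posPart (t ∧ₜ u) ≡ posPart t ∧ₜ posPart u
posPart-∧ₜ zeroT     u         = refl
posPart-∧ₜ (lits ls) zeroT     = refl
posPart-∧ₜ (lits ls) (lits ms) = cong lits (posLits-++ ls ms)

evalTerm-posPart-∧ₜ : ∀ (t u : Term n) x →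
  evalTerm (posPart (t ∧ₜ u)) x ≡ evalTerm (posPart t) x ∧ evalTerm (posPart u) x
evalTerm-posPart-∧ₜ t u x =
  trans (cong (λ s → evalTerm s x) (posPart-∧ₜ t u)) (evalTerm-∧ₜ (posPart t) (posPart u) x)

evalLits-posLits-∈ : ∀ {i} (ls : List (Literal n)) x →
  pos i ∈ ls → evalLits (posLits ls) x ≡ true → x i ≡ true
evalLits-posLits-∈ (pos i ∷ ls) x (here refl) e = proj₁ (∧-true⁻ e)
evalLits-posLits-∈ (pos j ∷ ls) x (there m)   e = evalLits-posLits-∈ ls x m (proj₂ (∧-true⁻ e))
evalLits-posLits-∈ (neg j ∷ ls) x (there m)   e = evalLits-posLits-∈ ls x m e

positives : List (Literal n) → Input n
positives ls i = does (any? (pos i ≟ₗ_) ls)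

positives-≤ᵥ : ∀ (ls : List (Literal n)) {x} → evalLits (posLits ls) x ≡ true → positives ls ≤ᵥ x
positives-≤ᵥ ls {x} e i with any? (pos i ≟ₗ_) ls
... | yes m = ≤-reflexive (sym (evalLits-posLits-∈ ls x m e))
... | no _  = ≤-minimum (x i)

zeroTerm⊎positives-satisfies : ∀ (ls : List (Literal n)) →
  ZeroTerm (lits ls) ⊎ evalLits ls (positives ls) ≡ true
zeroTerm⊎positives-satisfies ls = go ls (λ m → m)
  where
  go : ∀ ms → ms ⊆ ls → ZeroTerm (lits ls) ⊎ evalLits ms (positives ls) ≡ true
  go []           _   = inj₂ refl
  go (pos i ∷ ms) sub =
    Sum.map₂ (∧-true (Dec.dec-true (any? (pos i ≟ₗ_) ls) (sub (here refl)))) (go ms (sub ∘ there))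
  go (neg i ∷ ms) sub with any? (pos i ≟ₗ_) ls
  ... | yes m = inj₁ (i , m , sub (here refl))
  ... | no _  = go ms (sub ∘ there)

zeroTerm⊎posPart-implicant-up : ∀ (t : Term n) → ZeroTerm t ⊎ Implicant (posPart t) (Up (evalTerm t))
zeroTerm⊎posPart-implicant-up zeroT     = inj₂ λ _ ()
zeroTerm⊎posPart-implicant-up (lits ls) =
  Sum.map₂ (λ sat x e → positives ls , positives-≤ᵥ ls e , sat) (zeroTerm⊎positives-satisfies ls)

Up-mono : ∀ {f g : Input n → Bool} → (∀ z → f z ≡ true → g z ≡ true) → ∀ {x} → Up f x → Up g x
Up-mono f⊆g (z , z≤x , fz) = z , z≤x , f⊆g z fz

produced⇒implicant : ∀ {F : Circuit n} {t} → Produces F t → Implicant t (λ x → eval F x ≡ true)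
produced⇒implicant p-one       x e = refl
produced⇒implicant (p-lit l)   x e = trans (sym (∧-identityʳ (evalLit l x))) e
produced⇒implicant (p-orˡ p)   x e = ∨-trueˡ (produced⇒implicant p x e)
produced⇒implicant (p-orʳ p)   x e = ∨-trueʳ (produced⇒implicant p x e)
produced⇒implicant (p-and {t₁ = t} {t₂ = u} p q) x e =
  ∧-true-map (produced⇒implicant p x) (produced⇒implicant q x) (trans (sym (evalTerm-∧ₜ t u x)) e)

posPart-produced⇒implicant-mono : ∀ {F : Circuit n} {t} →
  Produces F t → Implicant (posPart t) (λ x → eval (mono F) x ≡ true)
posPart-produced⇒implicant-mono p-one             x e = refl
posPart-produced⇒implicant-mono (p-lit (pos i))   x e = trans (sym (∧-identityʳ (x i))) e
posPart-produced⇒implicant-mono (p-lit (neg i))   x e = refl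
posPart-produced⇒implicant-mono (p-orˡ p)         x e = ∨-trueˡ (posPart-produced⇒implicant-mono p x e)
posPart-produced⇒implicant-mono (p-orʳ p)         x e = ∨-trueʳ (posPart-produced⇒implicant-mono p x e)
posPart-produced⇒implicant-mono (p-and {t₁ = t} {t₂ = u} p q) x e =
  ∧-true-map (posPart-produced⇒implicant-mono p x) (posPart-produced⇒implicant-mono q x)
    (trans (sym (evalTerm-posPart-∧ₜ t u x)) e)

eval-mono⇒∃produced : ∀ (F : Circuit n) x → eval (mono F) x ≡ true →
  Σ (Term n) λ t → Produces F t × (evalTerm (posPart t) x ≡ true)
eval-mono⇒∃produced (const true)  x e = lits [] , p-one , refl
eval-mono⇒∃produced (lit (pos i)) x e = lits [ pos i ] , p-lit _ , trans (∧-identityʳ (x i)) e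
eval-mono⇒∃produced (lit (neg i)) x e = lits [ neg i ] , p-lit _ , refl
eval-mono⇒∃produced (or F G) x e with ∨-true⁻ e
... | inj₁ eF = let t , p , et = eval-mono⇒∃produced F x eF in t , p-orˡ p , et
... | inj₂ eG = let t , p , et = eval-mono⇒∃produced G x eG in t , p-orʳ p , et
eval-mono⇒∃produced (and F G) x e =
  let eF , eG = ∧-true⁻ e
      t , p , et = eval-mono⇒∃produced F x eF
      u , q , eu = eval-mono⇒∃produced G x eG
  in t ∧ₜ u , p-and p q , trans (evalTerm-posPart-∧ₜ t u x) (∧-true et eu)

eval-mono-monotone : ∀ (F : Circuit n) {z x} → z ≤ᵥ x → eval (mono F) z ≡ true → eval (mono F) x ≡ true
eval-mono-monotone (const b)     z≤x e = e
eval-mono-monotone (lit (pos i)) z≤x e = ≤-true (z≤x i) e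
eval-mono-monotone (lit (neg i)) z≤x e = refl
eval-mono-monotone (and F G)     z≤x = ∧-true-map (eval-mono-monotone F z≤x) (eval-mono-monotone G z≤x)
eval-mono-monotone (or F G)      z≤x = ∨-true-map (eval-mono-monotone F z≤x) (eval-mono-monotone G z≤x)

eval⇒eval-mono : ∀ (F : Circuit n) {x} → eval F x ≡ true → eval (mono F) x ≡ true
eval⇒eval-mono (const b)     e = e
eval⇒eval-mono (lit (pos i)) e = e
eval⇒eval-mono (lit (neg i)) e = refl
eval⇒eval-mono (and F G)     = ∧-true-map (eval⇒eval-mono F) (eval⇒eval-mono G)
eval⇒eval-mono (or F G)      = ∨-true-map (eval⇒eval-mono F) (eval⇒eval-mono G)

up⇒eval-mono : ∀ (F : Circuit n) {x} → Up (eval F) x → eval (mono F) x ≡ true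
up⇒eval-mono F (z , z≤x , ez) = eval-mono-monotone F z≤x (eval⇒eval-mono F ez)

theorem2 : ∀ {n : ℕ} (F : Circuit n) →
    Computes (mono F) (Up (eval F))
      ⇔ (∀ t → Produces F t → ZeroTerm t → Implicant (posPart t) (Up (eval F)))
theorem2 F = mk⇔ necessary sufficient
  where
  necessary : Computes (mono F) (Up (eval F)) →
    ∀ t → Produces F t → ZeroTerm t → Implicant (posPart t) (Up (eval F))
  necessary computes t p _ x e = proj₁ (computes x) (posPart-produced⇒implicant-mono p x e)

  sufficient : (∀ t → Produces F t → ZeroTerm t → Implicant (posPart t) (Up (eval F))) →
    Computes (mono F) (Up (eval F))
  sufficient zeroTerms-ok x = mono⇒up , up⇒eval-mono F
    where
    mono⇒up : eval (mono F) x ≡ true → Up (eval F) x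
    mono⇒up e with eval-mono⇒∃produced F x e
    ... | t , p , e⁺ with zeroTerm⊎posPart-implicant-up t
    ...   | inj₁ zero  = zeroTerms-ok t p zero x e⁺
    ...   | inj₂ t⁺≤t↑ = Up-mono (produced⇒implicant p) (t⁺≤t↑ x e⁺)
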